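{- Let $Q=\{q_1,\dots,q_n\}$ be a finite list of positive integers with $n\ge1$, let $m,k\ge 0$ be integers, let $j\in[n]$, and let $Q\setminus\{q_j\}$ denote the list obtained from $Q$ by deleting the entry $q_j$. Then $$\binom{m,n}{k,Q}=\sum_{i=0}^{q_j-1}\binom{m+i,\,n-1}{k,\,Q\setminus\{q_j\}}$$ and $$\binom{m,n}{k,Q}=\sum_{i=1}^{q_j}\binom{q_j}{i}\binom{m,\,n-1}{k-i+1,\,Q\setminus\{q_j\}}.$$
   Context: For a finite list $Q=\{q_1,\dots,q_n\}$ of positive integers (repetitions allowed) and a nonnegative integer $m$, let $X$ be a set which is the disjoint union of "main blocks" $X_1,\dots,X_n$ with $|X_i|=q_i$ and an "additional block" $Y$ with $|Y|=m$. An $(n+k)$-inset of $X$ is an $(n+k)$-element subset of $X$ that intersects every main block. The number of $(n+k)$-insets of $X$ is denoted $\binom{m,n}{k,Q}$; by this definition it equals $0$ when $k<0$, and for $n=0$ (no main blocks) it equals the ordinary binomial coefficient $\binom{m}{k}$. -}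

module Defs where

open import Data.Nat using (ℕ; zero; suc; _+_; _≡ᵇ_; _<ᵇ_)
open import Data.Bool using (Bool; true; false; _∧_)
open import Data.Product using (_×_; _,_)
open import Data.List using (List; []; _∷_; length; map; concatMap; filterᵇ)
open import Data.Vec using (_∷_; [])
open import Data.Fin.Subset using (Subset; ∣_∣)
open import Data.Integer using (ℤ; +_; -[1+_])

allSubsets : (n : ℕ) → List (Subset n)
allSubsets zero = [] ∷ []
allSubsets (suc n) = concatMap (λ p → (false ∷ p) ∷ (true ∷ p) ∷ []) (allSubsets n)

-- X = X₁ ⊎ … ⊎ Xₙ ⊎ Y with |Xᵢ| = qᵢ, |Y| = m.  A subset of X is the same as
-- a subset of each block; SubsetX Q m is the type of subsets of X.
SubsetX : List ℕ → ℕ → Set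
SubsetX [] m = Subset m
SubsetX (q ∷ Q) m = Subset q × SubsetX Q m

allSubsetsX : (Q : List ℕ) (m : ℕ) → List (SubsetX Q m)
allSubsetsX [] m = allSubsets m
allSubsetsX (q ∷ Q) m =
  concatMap (λ p → map (λ s → (p , s)) (allSubsetsX Q m)) (allSubsets q)

card : (Q : List ℕ) (m : ℕ) → SubsetX Q m → ℕ
card [] m s = ∣ s ∣
card (q ∷ Q) m (p , s) = ∣ p ∣ + card Q m s

meetsAllMain : (Q : List ℕ) (m : ℕ) → SubsetX Q m → Bool
meetsAllMain [] m s = true
meetsAllMain (q ∷ Q) m (p , s) = (0 <ᵇ ∣ p ∣) ∧ meetsAllMain Q m s

isInset : (Q : List ℕ) (m k : ℕ) → SubsetX Q m → Bool
isInset Q m k s = (card Q m s ≡ᵇ (length Q + k)) ∧ meetsAllMain Q m s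

insetCount : (m : ℕ) (Q : List ℕ) (k : ℤ) → ℕ
insetCount m Q (+ k) = length (filterᵇ (isInset Q m k) (allSubsetsX Q m))
insetCount m Q -[1+ _ ] = 0

-- Σ_{i=a}^{b} f i  (empty if b < a): sum over i = a, a+1, …, a+len-1
sumFrom : ℕ → ℕ → (ℕ → ℕ) → ℕ
sumFrom a zero f = 0
sumFrom a (suc len) f = f a + sumFrom (suc a) len f

-- Move the main block X_j to the front (the count is symmetric in the blocks) and split a
-- subset of X according to its part in X_j.  Grouping by the size i ≥ 1 of that part gives
-- the second identity: (q_j choose i) choices, and the rest is an (n-1+(k-i+1))-inset of
-- the other blocks.  For the first, split a block of size q+1 on one point: either the point
-- is absent, leaving a block of size q, or present, and then the block is met whatever the
-- other q points do, so they behave like q extra points of Y.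
module Submission where

open import Defs
open import Data.Nat using (ℕ; _+_; _*_; _<_; _≤_)
open import Data.Nat.Combinatorics using (_C_)
open import Data.Integer using (ℤ; +_; _-_) renaming (_+_ to _+ℤ_)
open import Data.List using (List; length; lookup; removeAt)
open import Data.List.Relation.Unary.All using (All)
open import Data.Fin using (Fin)
open import Data.Product using (_×_)
open import Relation.Binary.PropositionalEquality using (_≡_)

import Algebra.Properties.CommutativeSemigroup as CommutativeSemigroupProperties
open import Data.Bool using (Bool; true; false; _∧_; if_then_else_; T)
open import Data.Bool.Properties using (∧-zeroʳ)
import Data.Fin as Fin
open import Data.Fin.Subset using (Subset; ∣_∣)
open import Data.Integer using (_⊖_; -_)
import Data.Integer.Properties as ℤ
open import Data.Integer.Tactic.RingSolver using (solve-∀)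
open import Data.List using ([]; _∷_; _++_; map; concatMap; filterᵇ)
open import Data.List.Properties using (length-removeAt′)
open import Data.Nat using (zero; suc; _∸_; _≡ᵇ_; _<ᵇ_; _≤?_; z≤n; s≤s)
open import Data.Nat.Combinatorics using (nCk+nC[k+1]≡[n+1]C[k+1]; k>n⇒nCk≡0)
open import Data.Nat.Properties
open import Data.Product using (_,_)
open import Data.Unit using (tt)
open import Data.Vec using (_∷_)
open import Function using (_∘_; const)
open import Relation.Binary.PropositionalEquality
  using (refl; sym; trans; cong; cong₂; subst; _≗_; module ≡-Reasoning)
open import Relation.Nullary using (yes; no; contradiction)

open ≡-Reasoning

private
  variable
    A B : Set

  module +-CS = CommutativeSemigroupProperties +-commutativeSemigroup

∑ : List A → (A → ℕ) → ℕ
∑ [] f = 0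
∑ (x ∷ xs) f = f x + ∑ xs f

syntax ∑ xs (λ x → e) = ∑[ x ∈ xs ] e

∑-cong : ∀ (xs : List A) {f g : A → ℕ} → f ≗ g → ∑ xs f ≡ ∑ xs g
∑-cong [] f≗g = refl
∑-cong (x ∷ xs) f≗g = cong₂ _+_ (f≗g x) (∑-cong xs f≗g)

∑-zero : ∀ (xs : List A) → ∑ xs (const 0) ≡ 0
∑-zero [] = refl
∑-zero (x ∷ xs) = ∑-zero xs

∑-++ : ∀ (xs ys : List A) f → ∑ (xs ++ ys) f ≡ ∑ xs f + ∑ ys f
∑-++ [] ys f = refl
∑-++ (x ∷ xs) ys f = trans (cong (_+_ (f x)) (∑-++ xs ys f)) (sym (+-assoc (f x) _ _))

∑-map : ∀ (g : A → B) xs f → ∑ (map g xs) f ≡ ∑ xs (f ∘ g)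
∑-map g [] f = refl
∑-map g (x ∷ xs) f = cong (_+_ (f (g x))) (∑-map g xs f)

∑-concatMap : ∀ (g : A → List B) xs f → ∑ (concatMap g xs) f ≡ ∑[ x ∈ xs ] ∑ (g x) f
∑-concatMap g [] f = refl
∑-concatMap g (x ∷ xs) f =
  trans (∑-++ (g x) (concatMap g xs) f) (cong (_+_ (∑ (g x) f)) (∑-concatMap g xs f))

∑-+ : ∀ (xs : List A) f g → ∑[ x ∈ xs ] (f x + g x) ≡ ∑ xs f + ∑ xs g
∑-+ [] f g = refl
∑-+ (x ∷ xs) f g =
  trans (cong (_+_ (f x + g x)) (∑-+ xs f g)) (+-CS.interchange (f x) (g x) _ _)

∑-comm : ∀ (xs : List A) (ys : List B) (f : A → B → ℕ) →
  ∑[ x ∈ xs ] ∑[ y ∈ ys ] f x y ≡ ∑[ y ∈ ys ] ∑[ x ∈ xs ] f x y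
∑-comm [] ys f = sym (∑-zero ys)
∑-comm (x ∷ xs) ys f =
  trans (cong (_+_ (∑ ys (f x))) (∑-comm xs ys f)) (sym (∑-+ ys (f x) _))

indicator : Bool → ℕ
indicator b = if b then 1 else 0

length-filterᵇ : ∀ (p : A → Bool) xs → length (filterᵇ p xs) ≡ ∑[ x ∈ xs ] indicator (p x)
length-filterᵇ p [] = refl
length-filterᵇ p (x ∷ xs) with p x
... | true = cong suc (length-filterᵇ p xs)
... | false = length-filterᵇ p xs

sumFrom-cong : ∀ a n {f g : ℕ → ℕ} → (∀ i → a ≤ i → f i ≡ g i) → sumFrom a n f ≡ sumFrom a n g
sumFrom-cong a zero f≗g = refl
sumFrom-cong a (suc n) f≗g =
  cong₂ _+_ (f≗g a ≤-refl) (sumFrom-cong (suc a) n (λ i a<i → f≗g i (<⇒≤ a<i)))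

sumFrom-suc : ∀ a n f → sumFrom (suc a) n f ≡ sumFrom a n (f ∘ suc)
sumFrom-suc a zero f = refl
sumFrom-suc a (suc n) f = cong (_+_ (f (suc a))) (sumFrom-suc (suc a) n f)

sumFrom-snoc : ∀ a n f → sumFrom a (suc n) f ≡ sumFrom a n f + f (a + n)
sumFrom-snoc a zero f = trans (+-identityʳ (f a)) (cong f (sym (+-identityʳ a)))
sumFrom-snoc a (suc n) f = begin
  f a + sumFrom (suc a) (suc n) f                ≡⟨ cong (_+_ (f a)) (sumFrom-snoc (suc a) n f) ⟩
  f a + (sumFrom (suc a) n f + f (suc (a + n)))  ≡⟨ +-assoc (f a) _ _ ⟨
  f a + sumFrom (suc a) n f + f (suc (a + n))
    ≡⟨ cong (λ i → f a + sumFrom (suc a) n f + f i) (+-suc a n) ⟨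
  f a + sumFrom (suc a) n f + f (a + suc n)      ∎

sumFrom-+ : ∀ a n f g → sumFrom a n (λ i → f i + g i) ≡ sumFrom a n f + sumFrom a n g
sumFrom-+ a zero f g = refl
sumFrom-+ a (suc n) f g =
  trans (cong (_+_ (f a + g a)) (sumFrom-+ (suc a) n f g)) (+-CS.interchange (f a) (g a) _ _)

sumFrom-binomial-top : ∀ q (g : ℕ → ℕ) →
  sumFrom 1 (suc q) (λ a → (q C a) * g a) ≡ sumFrom 1 q (λ a → (q C a) * g a)
sumFrom-binomial-top q g = begin
  sumFrom 1 (suc q) h          ≡⟨ sumFrom-snoc 1 q h ⟩
  sumFrom 1 q h + h (suc q)    ≡⟨ cong (λ c → sumFrom 1 q h + c * g (suc q)) (k>n⇒nCk≡0 (n<1+n q)) ⟩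
  sumFrom 1 q h + 0            ≡⟨ +-identityʳ _ ⟩
  sumFrom 1 q h                ∎
  where
  h : ℕ → ℕ
  h a = (q C a) * g a

∑-allSubsets-suc : ∀ q (f : Subset (suc q) → ℕ) →
  ∑ (allSubsets (suc q)) f ≡ ∑[ p ∈ allSubsets q ] (f (false ∷ p) + f (true ∷ p))
∑-allSubsets-suc q f = trans (∑-concatMap _ (allSubsets q) f)
  (∑-cong (allSubsets q) (λ p → cong (_+_ (f (false ∷ p))) (+-identityʳ _)))

∑-allSubsetsX-∷ : ∀ q R m (f : SubsetX (q ∷ R) m → ℕ) →
  ∑ (allSubsetsX (q ∷ R) m) f ≡ ∑[ x ∈ allSubsets q ] ∑[ s ∈ allSubsetsX R m ] f (x , s)
∑-allSubsetsX-∷ q R m f = trans (∑-concatMap _ (allSubsets q) f)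
  (∑-cong (allSubsets q) (λ x → ∑-map (x ,_) (allSubsetsX R m) f))

∑-allSubsets-size : ∀ q (h : ℕ → ℕ) →
  ∑[ x ∈ allSubsets q ] h ∣ x ∣ ≡ sumFrom 0 (suc q) (λ a → (q C a) * h a)
∑-allSubsets-size zero h = cong (λ c → c + 0) (sym (+-identityʳ (h 0)))
∑-allSubsets-size (suc q) h = begin
  ∑[ x ∈ allSubsets (suc q) ] h ∣ x ∣
    ≡⟨ trans (∑-allSubsets-suc q _) (∑-+ (allSubsets q) _ _) ⟩
  ∑[ x ∈ allSubsets q ] h ∣ x ∣ + ∑[ x ∈ allSubsets q ] h (suc ∣ x ∣)
    ≡⟨ cong₂ _+_ (∑-allSubsets-size q h) (∑-allSubsets-size q (h ∘ suc)) ⟩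
  (1 * h 0 + sumFrom 1 q (λ a → (q C a) * h a)) + lower
    ≡⟨ cong (λ s → (1 * h 0 + s) + lower) (sym (sumFrom-binomial-top q h)) ⟩
  (1 * h 0 + upper) + lower
    ≡⟨ +-assoc (1 * h 0) upper lower ⟩
  1 * h 0 + (upper + lower)
    ≡⟨ cong (_+_ (1 * h 0)) (+-comm upper lower) ⟩
  1 * h 0 + (lower + upper)
    ≡⟨ cong (_+_ (1 * h 0)) (cong (_+_ lower) (sumFrom-suc 0 (suc q) _)) ⟩
  1 * h 0 + (lower + sumFrom 0 (suc q) (λ a → (q C suc a) * h (suc a)))
    ≡⟨ cong (_+_ (1 * h 0))
         (sumFrom-+ 0 (suc q) (λ a → (q C a) * h (suc a)) (λ a → (q C suc a) * h (suc a))) ⟨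
  1 * h 0 + sumFrom 0 (suc q) (λ a → (q C a) * h (suc a) + (q C suc a) * h (suc a))
    ≡⟨ cong (_+_ (1 * h 0)) (sumFrom-cong 0 (suc q) (λ a _ → pascal a)) ⟩
  1 * h 0 + sumFrom 0 (suc q) (λ a → (suc q C suc a) * h (suc a))
    ≡⟨ cong (_+_ (1 * h 0)) (sumFrom-suc 0 (suc q) _) ⟨
  sumFrom 0 (suc (suc q)) (λ a → (suc q C a) * h a)
    ∎
  where
  upper lower : ℕ
  upper = sumFrom 1 (suc q) (λ a → (q C a) * h a)
  lower = sumFrom 0 (suc q) (λ a → (q C a) * h (suc a))
  pascal : ∀ a → (q C a) * h (suc a) + (q C suc a) * h (suc a) ≡ (suc q C suc a) * h (suc a)
  pascal a = trans (sym (*-distribʳ-+ (h (suc a)) (q C a) (q C suc a)))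
                   (cong (_* h (suc a)) (nCk+nC[k+1]≡[n+1]C[k+1] q a))

countMeeting : (Q : List ℕ) (m : ℕ) → (ℕ → Bool) → ℕ
countMeeting Q m φ = ∑[ s ∈ allSubsetsX Q m ] indicator (φ (card Q m s) ∧ meetsAllMain Q m s)

insetCount≡countMeeting : ∀ m Q k → insetCount m Q (+ k) ≡ countMeeting Q m (_≡ᵇ length Q + k)
insetCount≡countMeeting m Q k = length-filterᵇ (isInset Q m k) (allSubsetsX Q m)

countMeeting-cong : ∀ R m {φ ψ : ℕ → Bool} → φ ≗ ψ → countMeeting R m φ ≡ countMeeting R m ψ
countMeeting-cong R m φ≗ψ = ∑-cong (allSubsetsX R m)
  (λ s → cong (λ b → indicator (b ∧ meetsAllMain R m s)) (φ≗ψ _))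

countMeeting-∷ : ∀ q R m φ → countMeeting (q ∷ R) m φ ≡
  ∑[ x ∈ allSubsets q ] (if 0 <ᵇ ∣ x ∣ then countMeeting R m (φ ∘ _+_ ∣ x ∣) else 0)
countMeeting-∷ q R m φ = trans (∑-allSubsetsX-∷ q R m _)
  (∑-cong (allSubsets q) (λ x → guard (0 <ᵇ ∣ x ∣) (φ ∘ _+_ ∣ x ∣)))
  where
  guard : ∀ b ψ → ∑[ s ∈ allSubsetsX R m ] indicator (ψ (card R m s) ∧ (b ∧ meetsAllMain R m s))
                  ≡ (if b then countMeeting R m ψ else 0)
  guard true ψ = refl
  guard false ψ = trans (∑-cong (allSubsetsX R m) (λ s → cong indicator (∧-zeroʳ _)))
                        (∑-zero (allSubsetsX R m))

countMeeting-swap : ∀ p q R m φ → countMeeting (p ∷ q ∷ R) m φ ≡ countMeeting (q ∷ p ∷ R) m φ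
countMeeting-swap p q R m φ = begin
  countMeeting (p ∷ q ∷ R) m φ
    ≡⟨ unfold p q ⟩
  ∑[ x ∈ allSubsets p ] ∑[ y ∈ allSubsets q ] pair x y
    ≡⟨ ∑-comm (allSubsets p) (allSubsets q) pair ⟩
  ∑[ y ∈ allSubsets q ] ∑[ x ∈ allSubsets p ] pair x y
    ≡⟨ ∑-cong (allSubsets q) (λ y → ∑-cong (allSubsets p) (pair-comm y)) ⟩
  ∑[ y ∈ allSubsets q ] ∑[ x ∈ allSubsets p ] pair y x
    ≡⟨ unfold q p ⟨
  countMeeting (q ∷ p ∷ R) m φ
    ∎
  where
  pair : ∀ {a b} → Subset a → Subset b → ℕ
  pair x y = ∑[ s ∈ allSubsetsX R m ]
    indicator (φ (∣ x ∣ + (∣ y ∣ + card R m s))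
               ∧ ((0 <ᵇ ∣ x ∣) ∧ ((0 <ᵇ ∣ y ∣) ∧ meetsAllMain R m s)))

  unfold : ∀ a b →
    countMeeting (a ∷ b ∷ R) m φ ≡ ∑[ x ∈ allSubsets a ] ∑[ y ∈ allSubsets b ] pair x y
  unfold a b = trans (∑-allSubsetsX-∷ a (b ∷ R) m _)
                     (∑-cong (allSubsets a) (λ x → ∑-allSubsetsX-∷ b R m _))

  ∧-swap : ∀ a b {c} → a ∧ (b ∧ c) ≡ b ∧ (a ∧ c)
  ∧-swap true b = refl
  ∧-swap false true = refl
  ∧-swap false false = refl

  pair-comm : ∀ {a b} (y : Subset b) (x : Subset a) → pair x y ≡ pair y x
  pair-comm y x = ∑-cong (allSubsetsX R m) (λ s → cong indicator
    (cong₂ _∧_ (cong φ (+-CS.x∙yz≈y∙xz ∣ x ∣ ∣ y ∣ (card R m s)))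
               (∧-swap (0 <ᵇ ∣ x ∣) (0 <ᵇ ∣ y ∣))))

countMeeting-removeAt : ∀ Q (j : Fin (length Q)) m φ →
  countMeeting Q m φ ≡ countMeeting (lookup Q j ∷ removeAt Q j) m φ
countMeeting-removeAt (q ∷ Q) Fin.zero m φ = refl
countMeeting-removeAt (p ∷ Q) (Fin.suc j) m φ = begin
  countMeeting (p ∷ Q) m φ
    ≡⟨ countMeeting-∷ p Q m φ ⟩
  ∑[ x ∈ allSubsets p ] (if 0 <ᵇ ∣ x ∣ then countMeeting Q m (φ ∘ _+_ ∣ x ∣) else 0)
    ≡⟨ ∑-cong (allSubsets p) (λ x → cong (λ c → if 0 <ᵇ ∣ x ∣ then c else 0)
                                         (countMeeting-removeAt Q j m (φ ∘ _+_ ∣ x ∣))) ⟩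
  _ ≡⟨ countMeeting-∷ p (lookup Q j ∷ removeAt Q j) m φ ⟨
  countMeeting (p ∷ lookup Q j ∷ removeAt Q j) m φ
    ≡⟨ countMeeting-swap p (lookup Q j) (removeAt Q j) m φ ⟩
  countMeeting (lookup Q j ∷ p ∷ removeAt Q j) m φ
    ∎

countMeeting-sucʸ : ∀ R m φ →
  countMeeting R (suc m) φ ≡ countMeeting R m φ + countMeeting R m (φ ∘ suc)
countMeeting-sucʸ [] m φ = trans (∑-allSubsets-suc m _) (∑-+ (allSubsets m) _ _)
countMeeting-sucʸ (p ∷ R) m φ = begin
  countMeeting (p ∷ R) (suc m) φ
    ≡⟨ countMeeting-∷ p R (suc m) φ ⟩
  ∑[ x ∈ allSubsets p ] (if 0 <ᵇ ∣ x ∣ then countMeeting R (suc m) (φ ∘ _+_ ∣ x ∣) else 0)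
    ≡⟨ ∑-cong (allSubsets p)
         (λ x → split (0 <ᵇ ∣ x ∣) (φ ∘ _+_ ∣ x ∣) (λ y → cong φ (+-suc ∣ x ∣ y))) ⟩
  ∑[ x ∈ allSubsets p ] ((if 0 <ᵇ ∣ x ∣ then countMeeting R m (φ ∘ _+_ ∣ x ∣) else 0)
                       + (if 0 <ᵇ ∣ x ∣ then countMeeting R m (φ ∘ suc ∘ _+_ ∣ x ∣) else 0))
    ≡⟨ ∑-+ (allSubsets p) _ _ ⟩
  _ ≡⟨ cong₂ _+_ (countMeeting-∷ p R m φ) (countMeeting-∷ p R m (φ ∘ suc)) ⟨
  countMeeting (p ∷ R) m φ + countMeeting (p ∷ R) m (φ ∘ suc)
    ∎
  where
  split : ∀ b ψ {χ} → ψ ∘ suc ≗ χ →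
    (if b then countMeeting R (suc m) ψ else 0)
      ≡ (if b then countMeeting R m ψ else 0) + (if b then countMeeting R m χ else 0)
  split true ψ ψ∘suc≗χ =
    trans (countMeeting-sucʸ R m ψ) (cong (_+_ _) (countMeeting-cong R m ψ∘suc≗χ))
  split false ψ _ = refl

countMeeting-absorb : ∀ R m q φ →
  ∑[ x ∈ allSubsets q ] countMeeting R m (φ ∘ _+_ ∣ x ∣) ≡ countMeeting R (m + q) φ
countMeeting-absorb R m zero φ =
  trans (+-identityʳ _) (cong (λ m′ → countMeeting R m′ φ) (sym (+-identityʳ m)))
countMeeting-absorb R m (suc q) φ = begin
  ∑[ x ∈ allSubsets (suc q) ] countMeeting R m (φ ∘ _+_ ∣ x ∣)
    ≡⟨ trans (∑-allSubsets-suc q _) (∑-+ (allSubsets q) _ _) ⟩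
  _ ≡⟨ cong₂ _+_ (countMeeting-absorb R m q φ) (countMeeting-absorb R m q (φ ∘ suc)) ⟩
  countMeeting R (m + q) φ + countMeeting R (m + q) (φ ∘ suc)
    ≡⟨ countMeeting-sucʸ R (m + q) φ ⟨
  countMeeting R (suc (m + q)) φ
    ≡⟨ cong (λ m′ → countMeeting R m′ φ) (+-suc m q) ⟨
  countMeeting R (m + suc q) φ
    ∎

countMeeting-byAdditional : ∀ q R m φ →
  countMeeting (q ∷ R) m φ ≡ sumFrom 0 q (λ i → countMeeting R (m + i) (φ ∘ suc))
countMeeting-byAdditional zero R m φ = countMeeting-∷ zero R m φ
countMeeting-byAdditional (suc q) R m φ = begin
  countMeeting (suc q ∷ R) m φ
    ≡⟨ countMeeting-∷ (suc q) R m φ ⟩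
  _ ≡⟨ trans (∑-allSubsets-suc q _) (∑-+ (allSubsets q) _ _) ⟩
  _ ≡⟨ cong₂ _+_ (sym (countMeeting-∷ q R m φ)) (countMeeting-absorb R m q (φ ∘ suc)) ⟩
  countMeeting (q ∷ R) m φ + countMeeting R (m + q) (φ ∘ suc)
    ≡⟨ cong (_+ countMeeting R (m + q) (φ ∘ suc)) (countMeeting-byAdditional q R m φ) ⟩
  sumFrom 0 q (λ i → countMeeting R (m + i) (φ ∘ suc)) + countMeeting R (m + q) (φ ∘ suc)
    ≡⟨ sumFrom-snoc 0 q _ ⟨
  sumFrom 0 (suc q) (λ i → countMeeting R (m + i) (φ ∘ suc))
    ∎

countMeeting-byBlockSize : ∀ q R m φ →
  countMeeting (q ∷ R) m φ ≡ sumFrom 1 q (λ i → (q C i) * countMeeting R m (φ ∘ _+_ i))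
countMeeting-byBlockSize q R m φ =
  trans (countMeeting-∷ q R m φ) (trans (∑-allSubsets-size q guarded) (sumFrom-cong 1 q nonempty))
  where
  guarded : ℕ → ℕ
  guarded i = if 0 <ᵇ i then countMeeting R m (φ ∘ _+_ i) else 0
  nonempty : ∀ i → 1 ≤ i → (q C i) * guarded i
                         ≡ (q C i) * countMeeting R m (φ ∘ _+_ i)
  nonempty (suc i) _ = refl

meetsAllMain⇒length≤card : ∀ R m s → T (meetsAllMain R m s) → length R ≤ card R m s
meetsAllMain⇒length≤card [] m s _ = z≤n
meetsAllMain⇒length≤card (p ∷ R) m (x , s) meets with ∣ x ∣
... | suc n = s≤s (≤-trans (meetsAllMain⇒length≤card R m s meets) (m≤n+m _ n))

countMeeting-vanish : ∀ R m φ → (∀ c → length R ≤ c → φ c ≡ false) → countMeeting R m φ ≡ 0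
countMeeting-vanish R m φ small = trans (∑-cong (allSubsetsX R m) term) (∑-zero (allSubsetsX R m))
  where
  term : ∀ s → indicator (φ (card R m s) ∧ meetsAllMain R m s) ≡ 0
  term s with meetsAllMain R m s | meetsAllMain⇒length≤card R m s
  ... | false | _ = cong indicator (∧-zeroʳ _)
  ... | true | bound rewrite small (card R m s) (bound tt) = refl

>⇒≡ᵇ≡false : ∀ {m n} → n < m → (m ≡ᵇ n) ≡ false
>⇒≡ᵇ≡false {m} {n} n<m with m ≡ᵇ n in eq
... | false = refl
... | true = contradiction (≡ᵇ⇒≡ m n (subst T (sym eq) tt)) (>⇒≢ n<m)

+-cancelˡ-≡ᵇ : ∀ a y z → (a + y ≡ᵇ a + z) ≡ (y ≡ᵇ z)
+-cancelˡ-≡ᵇ zero y z = refl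
+-cancelˡ-≡ᵇ (suc a) y z = +-cancelˡ-≡ᵇ a y z

insetCount-negative : ∀ m R n → 0 < n → insetCount m R (- (+ n)) ≡ 0
insetCount-negative m R (suc n) _ = refl

-- For a > k no subset meeting every block is small enough, matching insetCount's value 0
-- at negative arguments.
countMeeting-offset : ∀ R m k a →
  countMeeting R m (λ c → a + c ≡ᵇ length R + k) ≡ insetCount m R (k ⊖ a)
countMeeting-offset R m k a with a ≤? k
... | yes a≤k = begin
  countMeeting R m (λ c → a + c ≡ᵇ length R + k)
    ≡⟨ countMeeting-cong R m (λ c → trans (cong (λ t → a + c ≡ᵇ t) rest) (+-cancelˡ-≡ᵇ a c _)) ⟩
  countMeeting R m (_≡ᵇ length R + (k ∸ a))
    ≡⟨ insetCount≡countMeeting m R (k ∸ a) ⟨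
  insetCount m R (+ (k ∸ a))
    ≡⟨ cong (insetCount m R) (ℤ.⊖-≥ a≤k) ⟨
  insetCount m R (k ⊖ a)
    ∎
  where
  rest : length R + k ≡ a + (length R + (k ∸ a))
  rest = trans (cong (_+_ (length R)) (sym (m+[n∸m]≡n a≤k))) (+-CS.x∙yz≈y∙xz (length R) a (k ∸ a))
... | no a≰k = begin
  countMeeting R m (λ c → a + c ≡ᵇ length R + k)
    ≡⟨ countMeeting-vanish R m _ (λ c R≤c → >⇒≡ᵇ≡false
         (subst (length R + k <_) (+-comm c a) (+-mono-≤-< R≤c (≰⇒> a≰k)))) ⟩
  0
    ≡⟨ insetCount-negative m R (a ∸ k) (m<n⇒0<n∸m (≰⇒> a≰k)) ⟨
  insetCount m R (- (+ (a ∸ k)))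
    ≡⟨ cong (insetCount m R) (ℤ.⊖-< (≰⇒> a≰k)) ⟨
  insetCount m R (k ⊖ a)
    ∎

k-[1+a]+1≡k⊖a : ∀ k a → (+ k) - (+ suc a) +ℤ (+ 1) ≡ k ⊖ a
k-[1+a]+1≡k⊖a k a = trans (rearrange (+ k) (+ a)) (ℤ.m-n≡m⊖n k a)
  where
  rearrange : ∀ x y → x - (+ 1 +ℤ y) +ℤ + 1 ≡ x +ℤ - y
  rearrange = solve-∀

mainTheorem8 : (Q : List ℕ) → All (λ q → 0 < q) Q → 1 ≤ length Q →
    (m k : ℕ) (j : Fin (length Q)) →
      (insetCount m Q (+ k)
        ≡ sumFrom 0 (lookup Q j) (λ i → insetCount (m + i) (removeAt Q j) (+ k)))
      × (insetCount m Q (+ k)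
        ≡ sumFrom 1 (lookup Q j)
            (λ i → (lookup Q j C i) * insetCount m (removeAt Q j) ((+ k) - (+ i) +ℤ (+ 1))))
mainTheorem8 Q _ _ m k j =
  trans front (trans (countMeeting-byAdditional q R m size)
                     (sumFrom-cong 0 q (λ i _ → sym (insetCount≡countMeeting (m + i) R k)))) ,
  trans front (trans (countMeeting-byBlockSize q R m size) (sumFrom-cong 1 q byOffset))
  where
  q : ℕ
  q = lookup Q j
  R : List ℕ
  R = removeAt Q j
  size : ℕ → Bool
  size = _≡ᵇ suc (length R) + k
  front : insetCount m Q (+ k) ≡ countMeeting (q ∷ R) m size
  front = trans (insetCount≡countMeeting m Q k)
    (trans (countMeeting-removeAt Q j m (_≡ᵇ length Q + k))
           (cong (λ n → countMeeting (q ∷ R) m (_≡ᵇ n + k)) (length-removeAt′ Q j)))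
  byOffset : ∀ i → 1 ≤ i → (q C i) * countMeeting R m (λ c → i + c ≡ᵇ suc (length R) + k)
                         ≡ (q C i) * insetCount m R ((+ k) - (+ i) +ℤ (+ 1))
  byOffset (suc a) _ = cong ((q C suc a) *_)
    (trans (countMeeting-offset R m k a) (cong (insetCount m R) (sym (k-[1+a]+1≡k⊖a k a))))
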